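{- Let $\mathbf P=(P,\le,{}',0,1)$ be an orthoposet such that its Dedekind–MacNeille completion $\mathbf D(\mathbf P)$ is modular. Then: (i) $\mathbf P$ is strictly modular; (ii) if $M(x,y):=L(U(x,y'),y)$ and $R(x,y):=LU(L(x,y),x')$ for all $x,y\in P$, then $(P,\le,{}',M,R,0,1)$ is a divisible operator left residuated poset; (iii) there exists an extension ${}^*$ of $'$ to $D(\mathbf P)$ such that $(D(\mathbf P),\vee,\cap,{}^*,\{0\},P)$ is a modular ortholattice and hence an orthomodular lattice, and if one defines $A\odot B:=(A\vee B^*)\cap B$ and $A\rightarrow B:=(A\cap B)\vee A^*$ for all $A,B\in D(\mathbf P)$, then $(D(\mathbf P),\vee,\cap,\odot,\rightarrow,\{0\},P)$ is a divisible left residuated lattice.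
   Context: For $A\subseteq P$, $L(A)=\{x\in P\mid x\le y\ \forall y\in A\}$, $U(A)=\{x\in P\mid x\ge y\ \forall y\in A\}$; write $L(a,b)=L(\{a,b\})$, $L(a,A)=L(\{a\}\cup A)$, $L(A,B)=L(A\cup B)$, $LU(A)=L(U(A))$, etc. For $a\in P$, $A\subseteq P$: $a\le A$ means $a\le y$ for all $y\in A$; $A\le a$ means $y\le a$ for all $y\in A$. An orthoposet is a bounded poset with a unary operation $'$ that is a complementation ($U(x,x')=\{1\}$, $L(x,x')=\{0\}$) and an antitone involution. $\mathbf D(\mathbf P)$ is the Dedekind–MacNeille completion: $D(\mathbf P)=\{A\subseteq P\mid LU(A)=A\}$ ordered by inclusion, with $A\vee B=LU(A\cup B)$, $A\wedge B=A\cap B$, and $P$ embedded via $x\mapsto L(x)$. A poset is strictly modular if for all $x,y,z\in P$, $X,Z\subseteq P$: if $x\le Z$ then $L(U(x,y),Z)=LU(x,L(y,Z))$, and if $L(X)\le z$ then $L(U(L(X),y),z)=LU(L(X),L(y,z))$. An operator left residuated poset is $(P,\le,{}',M,R,0,1)$ with $(P,\le,{}',0,1)$ a bounded poset with unary operation and $M,R:P^2\to2^P$ such that for all $x,y,z$: $M(x,1)=M(1,x)=L(x)$; $M(x,y)\subseteq L(z)$ iff $L(x)\subseteq R(y,z)$; $R(x,0)=L(x')$; divisible if $M(R(x,y),x)=L(x,y)$ (with $M(A,y)=L(U(A,y'),y)$ for sets $A$). An ortholattice is a bounded lattice with a complementation that is an antitone involution; orthomodular if moreover $x\vee((x\vee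 y)\wedge x')=x\vee y$. A left residuated lattice is $(L,\vee,\wedge,\odot,\rightarrow,0,1)$ with $(L,\vee,\wedge,0,1)$ a bounded lattice, $x\odot1=1\odot x=x$, and $x\odot y\le z$ iff $x\le y\rightarrow z$; divisible if $(x\rightarrow y)\odot x=x\wedge y$. -}

module Defs where

open import Level using (0ℓ)
open import Data.Unit using (⊤; tt)
open import Data.Product using (Σ; ∃; _×_; _,_; proj₁; proj₂)
open import Function.Bundles using (_⇔_)
open import Relation.Unary using (Pred; _⊆_; _∪_; _∩_; ｛_｝; _≐_)
open import Relation.Binary.PropositionalEquality using (_≡_; refl)
open import Relation.Binary.Structures using (IsPartialOrder)
open import Relation.Binary.Lattice.Structures using (IsBoundedLattice)
open import Data.Sum using (inj₁; inj₂)

module Cones {P : Set} (_≤_ : P → P → Set) where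

  L : Pred P 0ℓ → Pred P 0ℓ
  L A x = ∀ y → A y → x ≤ y

  U : Pred P 0ℓ → Pred P 0ℓ
  U A x = ∀ y → A y → y ≤ x

  LU : Pred P 0ℓ → Pred P 0ℓ
  LU A = L (U A)

  ⟪_,_⟫ : P → P → Pred P 0ℓ
  ⟪ x , y ⟫ = ｛ x ｝ ∪ ｛ y ｝

  _≤ˢ_ : P → Pred P 0ℓ → Set
  a ≤ˢ A = ∀ y → A y → a ≤ y

  _ˢ≤_ : Pred P 0ℓ → P → Set
  A ˢ≤ a = ∀ y → A y → y ≤ a

record Orthoposet : Set₁ where
  field
    P              : Set
    _≤_            : P → P → Set
    isPartialOrder : IsPartialOrder _≡_ _≤_
    𝟎 𝟏            : P
    𝟎-min          : ∀ x → 𝟎 ≤ x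
    𝟏-max          : ∀ x → x ≤ 𝟏
    _′             : P → P
  infix 4 _≤_
  infix 8 _′
  open Cones _≤_
  field
    compl-U   : ∀ x → U ⟪ x , x ′ ⟫ ≐ ｛ 𝟏 ｝
    compl-L   : ∀ x → L ⟪ x , x ′ ⟫ ≐ ｛ 𝟎 ｝
    antitone  : ∀ x y → x ≤ y → y ′ ≤ x ′
    involution : ∀ x → (x ′) ′ ≡ x

module OnOrthoposet (𝐏 : Orthoposet) where
  open Orthoposet 𝐏
  open Cones _≤_ public
  open IsPartialOrder isPartialOrder using (reflexive; trans; antisym)
    renaming (refl to ≤-refl)

  L-anti : ∀ {A B} → A ⊆ B → L B ⊆ L A
  L-anti A⊆B xLB y yA = xLB y (A⊆B yA)

  U-anti : ∀ {A B} → A ⊆ B → U B ⊆ U A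
  U-anti A⊆B xUB y yA = xUB y (A⊆B yA)

  ext-LU : ∀ {A} → A ⊆ LU A
  ext-LU aA u uU = uU _ aA

  ext-UL : ∀ {A} → A ⊆ U (L A)
  ext-UL aA l lL = lL _ aA

  LUL≐L : ∀ A → LU (L A) ≐ L A
  LUL≐L A = (λ x y yA → x y (ext-UL yA)) , ext-LU

  record DM : Set₁ where
    constructor dm
    field
      carrier : Pred P 0ℓ
      closed  : LU carrier ≐ carrier
  open DM public

  infix 4 _≈_ _⊑_
  infixr 6 _∨_
  infixr 7 _∧_
  _≈_ : DM → DM → Set
  A ≈ B = carrier A ≐ carrier B

  _⊑_ : DM → DM → Set
  A ⊑ B = carrier A ⊆ carrier B

  Lᴰ : Pred P 0ℓ → DM
  Lᴰ A = dm (L A) (LUL≐L A)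

  _∨_ : DM → DM → DM
  A ∨ B = Lᴰ (U (carrier A ∪ carrier B))

  _∧_ : DM → DM → DM
  A ∧ B = dm (carrier A ∩ carrier B)
    ( (λ x → proj₁ (closed A) (L-anti (U-anti proj₁) x)
           , proj₁ (closed B) (L-anti (U-anti proj₂) x))
    , ext-LU )

  ι : P → DM
  ι x = Lᴰ ｛ x ｝

  ⊥ᴰ : DM
  ⊥ᴰ = dm ｛ 𝟎 ｝
    ( (λ {x} xLU → antisym (𝟎-min x) (xLU 𝟎 (λ { _ refl → ≤-refl })))
    , ext-LU )

  ⊤ᴰ : DM
  ⊤ᴰ = dm (λ _ → ⊤) ((λ _ → tt) , λ {x} _ u uU → trans (𝟏-max x) (uU 𝟏 tt))

  ModularD : Set₁
  ModularD = ∀ A B C → A ⊑ C → ((A ∨ B) ∧ C) ≈ (A ∨ (B ∧ C))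

  StrictlyModular : Set₁
  StrictlyModular =
    ∀ (x y z : P) (X Z : Pred P 0ℓ) →
      (x ≤ˢ Z → L (U ⟪ x , y ⟫ ∪ Z) ≐ LU (｛ x ｝ ∪ L (｛ y ｝ ∪ Z)))
    × (L X ˢ≤ z → L (U (L X ∪ ｛ y ｝) ∪ ｛ z ｝) ≐ LU (L X ∪ L ⟪ y , z ⟫))

  Mˢ : Pred P 0ℓ → P → Pred P 0ℓ
  Mˢ A y = L (U (A ∪ ｛ y ′ ｝) ∪ ｛ y ｝)

  IsDivisibleOpLeftResiduated : (M R : P → P → Pred P 0ℓ) → Set
  IsDivisibleOpLeftResiduated M R =
      (∀ x → M x 𝟏 ≐ L ｛ x ｝)
    × (∀ x → M 𝟏 x ≐ L ｛ x ｝)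
    × (∀ x y z → (M x y ⊆ L ｛ z ｝) ⇔ (L ｛ x ｝ ⊆ R y z))
    × (∀ x → R x 𝟎 ≐ L ｛ x ′ ｝)
    × (∀ x y → Mˢ (R x y) x ≐ L ⟪ x , y ⟫)

  M₀ : P → P → Pred P 0ℓ
  M₀ x y = L (U ⟪ x , y ′ ⟫ ∪ ｛ y ｝)

  R₀ : P → P → Pred P 0ℓ
  R₀ x y = LU (L ⟪ x , y ⟫ ∪ ｛ x ′ ｝)

  ExtendsComplement : (DM → DM) → Set
  ExtendsComplement _* = ∀ x → (ι x) * ≈ ι (x ′)

  IsBoundedLatticeD : Set₁
  IsBoundedLatticeD = IsBoundedLattice _≈_ _⊑_ _∨_ _∧_ ⊤ᴰ ⊥ᴰ

  IsOrthocomplementation : (DM → DM) → Set₁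
  IsOrthocomplementation _* =
      (∀ A → (A ∨ (A *)) ≈ ⊤ᴰ)
    × (∀ A → (A ∧ (A *)) ≈ ⊥ᴰ)
    × (∀ A B → A ⊑ B → (B *) ⊑ (A *))
    × (∀ A → ((A *) *) ≈ A)

  IsModularOrtholattice : (DM → DM) → Set₁
  IsModularOrtholattice _* = IsBoundedLatticeD × IsOrthocomplementation _* × ModularD

  IsOrthomodularLattice : (DM → DM) → Set₁
  IsOrthomodularLattice _* =
    IsBoundedLatticeD × IsOrthocomplementation _*
    × (∀ A B → (A ∨ ((A ∨ B) ∧ (A *))) ≈ (A ∨ B))

  ⊙[_] : (DM → DM) → DM → DM → DM
  ⊙[ _* ] A B = (A ∨ (B *)) ∧ B

  ⇒[_] : (DM → DM) → DM → DM → DM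
  ⇒[ _* ] A B = (A ∧ B) ∨ (A *)

  IsDivisibleLeftResiduatedLattice : (_⊙_ _⇒_ : DM → DM → DM) → Set₁
  IsDivisibleLeftResiduatedLattice _⊙_ _⇒_ =
      IsBoundedLatticeD
    × (∀ A → (A ⊙ ⊤ᴰ) ≈ A)
    × (∀ A → (⊤ᴰ ⊙ A) ≈ A)
    × (∀ A B C → ((A ⊙ B) ⊑ C) ⇔ (A ⊑ (B ⇒ C)))
    × (∀ A B → ((A ⇒ B) ⊙ A) ≈ (A ∧ B))

-- A* := L(A′) extends ′ to an orthocomplementation of the complete lattice D(P), so a modular
-- D(P) is a modular ortholattice and hence orthomodular. In a modular ortholattice the
-- operations A ⊙ B = (A ∨ B*) ∧ B and A → B = (A ∧ B) ∨ A* are residuated and divisible: both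
-- facts come from applying the modular law to B ∨ B* = ⊤ and B* ∧ B = ⊥. Under x ↦ L(x) the
-- sets M(x,y) and R(x,y) are L(x) ⊙ L(y) and L(x) → L(y), and the two strict modularity
-- identities are the modular law of D(P) for principal ideals and cuts L(Z), so (i) and (ii)
-- are these lattice facts read back in P.
module Submission where

open import Defs
open import Level using (0ℓ) renaming (suc to lsuc)
open import Data.Product using (Σ; _×_; _,_; proj₁; proj₂)
open import Data.Sum using (inj₁; inj₂)
open import Data.Unit using (tt)
open import Function.Bundles using (_⇔_; mk⇔; Equivalence)
open import Relation.Unary using (Pred; _⊆_; _≐_; _∪_; _∩_; ｛_｝)
open import Relation.Unary.Algebra using (∩-cong)
open import Relation.Unary.Properties using (≐-refl; ≐-sym; ≐-trans)
open import Relation.Unary.Relation.Binary.Equality using (≐-setoid)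
open import Relation.Binary.PropositionalEquality using (_≡_; refl; sym; subst)
open import Relation.Binary.Structures using (IsPreorder; IsPartialOrder)
open import Relation.Binary.Bundles using (Poset)
import Relation.Binary.Reasoning.Setoid as SetoidReasoning
import Relation.Binary.Reasoning.PartialOrder as PosetReasoning

module ConeProperties {P : Set} {_≤_ : P → P → Set} (isPreorder : IsPreorder _≡_ _≤_) where
  open Cones _≤_
  open IsPreorder isPreorder using (trans) renaming (refl to ≤-refl)

  L-∪ : ∀ {S T : Pred P 0ℓ} → L (S ∪ T) ≐ L S ∩ L T
  L-∪ = (λ x≤S∪T → (λ y s → x≤S∪T y (inj₁ s)) , (λ y t → x≤S∪T y (inj₂ t)))
      , (λ { (x≤S , _) y (inj₁ s) → x≤S y s ; (_ , x≤T) y (inj₂ t) → x≤T y t })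

  U-∪ : ∀ {S T : Pred P 0ℓ} → U (S ∪ T) ≐ U S ∩ U T
  U-∪ = (λ S∪T≤x → (λ y s → S∪T≤x y (inj₁ s)) , (λ y t → S∪T≤x y (inj₂ t)))
      , (λ { (S≤x , _) y (inj₁ s) → S≤x y s ; (_ , T≤x) y (inj₂ t) → T≤x y t })

  infix 4 _≈ᵁ_
  _≈ᵁ_ : Pred P 0ℓ → Pred P 0ℓ → Set
  S ≈ᵁ T = U S ≐ U T

  ≐⇒≈ᵁ : ∀ {S T} → S ≐ T → S ≈ᵁ T
  ≐⇒≈ᵁ (S⊆T , T⊆S) = (λ S≤x y t → S≤x y (T⊆S t)) , (λ T≤x y s → T≤x y (S⊆T s))

  LU-cong : ∀ {S T} → S ≈ᵁ T → LU S ≐ LU T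
  LU-cong (US⊆UT , UT⊆US) = (λ x∈LUS y y∈UT → x∈LUS y (UT⊆US y∈UT))
                          , (λ x∈LUT y y∈US → x∈LUT y (US⊆UT y∈US))

  ∪-congᵁ : ∀ {S S′ T T′} → S ≈ᵁ S′ → T ≈ᵁ T′ → S ∪ T ≈ᵁ S′ ∪ T′
  ∪-congᵁ S≈S′ T≈T′ = ≐-trans U-∪ (≐-trans (∩-cong S≈S′ T≈T′) (≐-sym U-∪))

  ｛｝≈ᵁL : ∀ {x} → ｛ x ｝ ≈ᵁ L ｛ x ｝
  ｛｝≈ᵁL {x} = (λ x≤u y y≤x → trans (y≤x x refl) (x≤u x refl))
             , (λ L≤u → λ { _ refl → L≤u x (λ { _ refl → ≤-refl }) })

module CompletionProperties (𝐏 : Orthoposet) where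
  open Orthoposet 𝐏
  open OnOrthoposet 𝐏
  open IsPartialOrder isPartialOrder using (isPreorder; reflexive)
    renaming (refl to ≤-refl; trans to ≤-trans)
  open ConeProperties isPreorder

  x′≤y⇒y′≤x : ∀ {x y} → x ′ ≤ y → y ′ ≤ x
  x′≤y⇒y′≤x {x} {y} x′≤y = subst (y ′ ≤_) (involution x) (antitone _ _ x′≤y)

  closure : ∀ A → LU (carrier A) ⊆ carrier A
  closure A = proj₁ (closed A)

  ∨-upperBoundˡ : ∀ A B → A ⊑ A ∨ B
  ∨-upperBoundˡ A B a _ A∪B≤u = A∪B≤u _ (inj₁ a)

  ∨-upperBoundʳ : ∀ A B → B ⊑ A ∨ B
  ∨-upperBoundʳ A B b _ A∪B≤u = A∪B≤u _ (inj₂ b)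

  ∨-least : ∀ {A B C} → A ⊑ C → B ⊑ C → A ∨ B ⊑ C
  ∨-least {C = C} A⊑C B⊑C x≤U =
    closure C (λ u C≤u → x≤U u λ { y (inj₁ a) → C≤u y (A⊑C a) ; y (inj₂ b) → C≤u y (B⊑C b) })

  ⊥ᴰ-minimum : ∀ A → ⊥ᴰ ⊑ A
  ⊥ᴰ-minimum A refl = closure A (λ u _ → 𝟎-min u)

  ⊑-isPartialOrder : IsPartialOrder _≈_ _⊑_
  ⊑-isPartialOrder = record
    { isPreorder = record
      { isEquivalence = record { refl = ≐-refl ; sym = ≐-sym ; trans = ≐-trans }
      ; reflexive     = proj₁
      ; trans         = λ A⊑B B⊑C a → B⊑C (A⊑B a)
      }
    ; antisym = _,_
    }

  ⊑-poset : Poset (lsuc 0ℓ) 0ℓ 0ℓ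
  ⊑-poset = record { isPartialOrder = ⊑-isPartialOrder }

  isBoundedLattice : IsBoundedLatticeD
  isBoundedLattice = record
    { isLattice = record
      { isPartialOrder = ⊑-isPartialOrder
      ; supremum = λ A B → ∨-upperBoundˡ A B , ∨-upperBoundʳ A B , λ C → ∨-least {A} {B} {C}
      ; infimum  = λ A B → proj₁ , proj₂ , λ C C⊑A C⊑B c → C⊑A c , C⊑B c
      }
    ; maximum = λ _ _ → tt
    ; minimum = ⊥ᴰ-minimum
    }

  -- A* = L(A′); as ′ is an involution, the image A′ is the preimage { z | z′ ∈ A }.
  infix 8 _*
  _* : DM → DM
  A * = Lᴰ (λ z → carrier A (z ′))

  ι-* : ExtendsComplement _*
  ι-* x = (λ x′≤ → λ { _ refl → x′≤ (x ′) (λ { _ refl → reflexive (involution x) }) })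
        , (λ w≤x′ z x≤z′ → ≤-trans (w≤x′ (x ′) refl) (x′≤y⇒y′≤x (x≤z′ x refl)))

  *-antitone : ∀ A B → A ⊑ B → B * ⊑ A *
  *-antitone A B A⊑B w≤B′ z a = w≤B′ z (A⊑B a)

  *-involutive : ∀ A → A * * ≈ A
  *-involutive A =
      (λ w≤A** → closure A (λ u A≤u → w≤A** u (λ v a → x′≤y⇒y′≤x (A≤u (v ′) a))))
    , (λ {a} Aa z z≤A′ → subst (_≤ z) (involution a)
                            (x′≤y⇒y′≤x (z≤A′ (a ′) (subst (carrier A) (sym (involution a)) Aa))))

  ∧-complementʳ : ∀ A → A ∧ A * ≈ ⊥ᴰ
  ∧-complementʳ A =
      (λ {w} (Aw , w≤A′) → proj₁ (compl-L w) λ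
        { _ (inj₁ refl) → ≤-refl
        ; _ (inj₂ refl) → w≤A′ (w ′) (subst (carrier A) (sym (involution w)) Aw) })
    , (λ 0∈ → ⊥ᴰ-minimum A 0∈ , ⊥ᴰ-minimum (A *) 0∈)

  ∧-complementˡ : ∀ A → A * ∧ A ≈ ⊥ᴰ
  ∧-complementˡ A = (λ (a* , a) → proj₁ (∧-complementʳ A) (a , a*))
                  , (λ 0∈ → ⊥ᴰ-minimum (A *) 0∈ , ⊥ᴰ-minimum A 0∈)

  -- Every upper bound u of A ∪ A* has u′ ∈ A*, so u ≥ u′ and complementation forces u = 𝟏.
  ∨-complementʳ : ∀ A → A ∨ A * ≈ ⊤ᴰ
  ∨-complementʳ A = (λ _ → tt) , λ {w} _ u A∪A*≤u →
    let u′∈A* : carrier (A *) (u ′)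
        u′∈A* z a = x′≤y⇒y′≤x (A∪A*≤u (z ′) (inj₁ a))
    in subst (w ≤_) (proj₁ (compl-U u) λ { _ (inj₁ refl) → ≤-refl
                                          ; _ (inj₂ refl) → A∪A*≤u (u ′) (inj₂ u′∈A*) })
                    (𝟏-max w)

  ∨-complementˡ : ∀ A → A * ∨ A ≈ ⊤ᴰ
  ∨-complementˡ A = (λ _ → tt)
                  , (λ t → ∨-least {A} {A *} {A * ∨ A} (∨-upperBoundʳ (A *) A) (∨-upperBoundˡ (A *) A)
                             (proj₂ (∨-complementʳ A) t))

  isOrthocomplementation : IsOrthocomplementation _*
  isOrthocomplementation = ∨-complementʳ , ∧-complementʳ , *-antitone , *-involutive

  _⊙_ _⇛_ : DM → DM → DM
  _⊙_ = ⊙[ _* ]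
  _⇛_ = ⇒[ _* ]

  ⊙-identityʳ : ∀ A → A ⊙ ⊤ᴰ ≈ A
  ⊙-identityʳ A = (λ (a∨⊤* , _) → ∨-least {A} {⊤ᴰ *} {A} (λ a → a)
                                     (λ t* → ⊥ᴰ-minimum A (proj₁ (∧-complementʳ ⊤ᴰ) (tt , t*))) a∨⊤*)
                , (λ a → ∨-upperBoundˡ A (⊤ᴰ *) a , tt)

  ⊙-identityˡ : ∀ A → ⊤ᴰ ⊙ A ≈ A
  ⊙-identityˡ A = proj₂ , (λ a → ∨-upperBoundˡ ⊤ᴰ (A *) tt , a)

module ModularCompletionProperties (𝐏 : Orthoposet) (modular : OnOrthoposet.ModularD 𝐏) where
  open OnOrthoposet 𝐏
  open CompletionProperties 𝐏
  open PosetReasoning ⊑-poset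

  modular-split : ∀ {X Y C} → X ⊑ C → ⊤ᴰ ⊑ X ∨ Y → C ⊑ X ∨ (Y ∧ C)
  modular-split {X} {Y} {C} X⊑C ⊤⊑X∨Y c = proj₁ (modular X Y C X⊑C) (⊤⊑X∨Y tt , c)

  modular-cancel : ∀ {X Y C} → X ⊑ C → Y ∧ C ⊑ ⊥ᴰ → (X ∨ Y) ∧ C ⊑ X
  modular-cancel {X} {Y} {C} X⊑C Y∧C⊑⊥ = begin
    (X ∨ Y) ∧ C  ≈⟨ modular X Y C X⊑C ⟩
    X ∨ (Y ∧ C)  ≤⟨ ∨-least {X} {Y ∧ C} {X} (λ x → x) (λ y∧c → ⊥ᴰ-minimum X (Y∧C⊑⊥ y∧c)) ⟩
    X            ∎

  orthomodular : ∀ A B → A ∨ ((A ∨ B) ∧ A *) ≈ A ∨ B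
  orthomodular A B =
      ∨-least {A} {(A ∨ B) ∧ A *} {A ∨ B} (∨-upperBoundˡ A B) proj₁
    , (λ a∨b → ∨-least {A} {A * ∧ (A ∨ B)} {A ∨ ((A ∨ B) ∧ A *)}
                 (∨-upperBoundˡ A ((A ∨ B) ∧ A *))
                 (λ (a* , a∨b) → ∨-upperBoundʳ A ((A ∨ B) ∧ A *) (a∨b , a*))
                 (modular-split {A} {A *} {A ∨ B} (∨-upperBoundˡ A B) (proj₂ (∨-complementʳ A)) a∨b))

  ⊙-⇛-residuated : ∀ A B C → (A ⊙ B ⊑ C) ⇔ (A ⊑ B ⇛ C)
  ⊙-⇛-residuated A B C = mk⇔ to from
    where
      to : A ⊙ B ⊑ C → A ⊑ B ⇛ C
      to A⊙B⊑C = begin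
        A                      ≤⟨ ∨-upperBoundˡ A (B *) ⟩
        A ∨ B *                ≤⟨ modular-split {B *} {B} {A ∨ B *} (∨-upperBoundʳ A (B *)) (proj₂ (∨-complementˡ B)) ⟩
        B * ∨ (B ∧ (A ∨ B *))  ≤⟨ ∨-least {B *} {B ∧ (A ∨ B *)} {B ⇛ C}
                                    (∨-upperBoundʳ (B ∧ C) (B *))
                                    (λ (b , a∨b*) → ∨-upperBoundˡ (B ∧ C) (B *) (b , A⊙B⊑C (a∨b* , b))) ⟩
        B ⇛ C                  ∎
      from : A ⊑ B ⇛ C → A ⊙ B ⊑ C
      from A⊑B⇛C = begin
        A ⊙ B                  ≤⟨ (λ (a∨b* , b) → ∨-least {A} {B *} {B ⇛ C} A⊑B⇛C (∨-upperBoundʳ (B ∧ C) (B *)) a∨b* , b) ⟩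
        ((B ∧ C) ∨ B *) ∧ B    ≤⟨ modular-cancel {B ∧ C} {B *} {B} proj₁ (proj₁ (∧-complementˡ B)) ⟩
        B ∧ C                  ≤⟨ proj₂ ⟩
        C                      ∎

  ⇛-⊙-divisible : ∀ A B → (A ⇛ B) ⊙ A ≈ A ∧ B
  ⇛-⊙-divisible A B =
      Equivalence.from (⊙-⇛-residuated (A ⇛ B) A (A ∧ B))
        (∨-least {A ∧ B} {A *} {A ⇛ (A ∧ B)}
          (λ (a , b) → ∨-upperBoundˡ (A ∧ (A ∧ B)) (A *) (a , a , b)) (∨-upperBoundʳ (A ∧ (A ∧ B)) (A *)))
    , (λ (a , b) → ∨-upperBoundˡ (A ⇛ B) (A *) (∨-upperBoundˡ (A ∧ B) (A *) (a , b)) , a)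

module EmbeddingProperties (𝐏 : Orthoposet) (modular : OnOrthoposet.ModularD 𝐏) where
  open Orthoposet 𝐏
  open OnOrthoposet 𝐏
  open IsPartialOrder isPartialOrder using (isPreorder)
    renaming (refl to ≤-refl; trans to ≤-trans)
  open ConeProperties isPreorder
  open CompletionProperties 𝐏
  open ModularCompletionProperties 𝐏 modular
  open SetoidReasoning (≐-setoid P 0ℓ)

  strictlyModular : StrictlyModular
  strictlyModular x y z X Z = first , second
    where
      first : x ≤ˢ Z → L (U ⟪ x , y ⟫ ∪ Z) ≐ LU (｛ x ｝ ∪ L (｛ y ｝ ∪ Z))
      first x≤Z = begin
        L (U ⟪ x , y ⟫ ∪ Z)            ≈⟨ L-∪ ⟩
        LU ⟪ x , y ⟫ ∩ L Z             ≈⟨ ∩-cong (LU-cong (∪-congᵁ ｛｝≈ᵁL ｛｝≈ᵁL)) ≐-refl ⟩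
        carrier ((ι x ∨ ι y) ∧ Lᴰ Z)   ≈⟨ modular (ι x) (ι y) (Lᴰ Z) (λ w≤x z Zz → ≤-trans (w≤x x refl) (x≤Z z Zz)) ⟩
        carrier (ι x ∨ (ι y ∧ Lᴰ Z))   ≈⟨ LU-cong (∪-congᵁ (≐-sym ｛｝≈ᵁL) (≐⇒≈ᵁ (≐-sym L-∪))) ⟩
        LU (｛ x ｝ ∪ L (｛ y ｝ ∪ Z))  ∎
      second : L X ˢ≤ z → L (U (L X ∪ ｛ y ｝) ∪ ｛ z ｝) ≐ LU (L X ∪ L ⟪ y , z ⟫)
      second LX≤z = begin
        L (U (L X ∪ ｛ y ｝) ∪ ｛ z ｝)  ≈⟨ L-∪ ⟩
        LU (L X ∪ ｛ y ｝) ∩ L ｛ z ｝   ≈⟨ ∩-cong (LU-cong (∪-congᵁ ≐-refl ｛｝≈ᵁL)) ≐-refl ⟩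
        carrier ((Lᴰ X ∨ ι y) ∧ ι z)    ≈⟨ modular (Lᴰ X) (ι y) (ι z) (λ w∈LX → λ { _ refl → LX≤z _ w∈LX }) ⟩
        carrier (Lᴰ X ∨ (ι y ∧ ι z))    ≈⟨ LU-cong (∪-congᵁ ≐-refl (≐⇒≈ᵁ (≐-sym L-∪))) ⟩
        LU (L X ∪ L ⟪ y , z ⟫)          ∎

  ｛′｝≈ᵁι* : ∀ x → ｛ x ′ ｝ ≈ᵁ carrier (ι x *)
  ｛′｝≈ᵁι* x = ≐-trans ｛｝≈ᵁL (≐⇒≈ᵁ (≐-sym (ι-* x)))

  Mˢ-⊙ : ∀ {A} B y → A ≈ᵁ carrier B → Mˢ A y ≐ carrier (B ⊙ ι y)
  Mˢ-⊙ B y A≈ᵁB = ≐-trans L-∪ (∩-cong (LU-cong (∪-congᵁ A≈ᵁB (｛′｝≈ᵁι* y))) ≐-refl)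

  M₀-⊙ : ∀ x y → M₀ x y ≐ carrier (ι x ⊙ ι y)
  M₀-⊙ x y = Mˢ-⊙ (ι x) y ｛｝≈ᵁL

  R₀-⇛ : ∀ x y → R₀ x y ≐ carrier (ι x ⇛ ι y)
  R₀-⇛ x y = LU-cong (∪-congᵁ (≐⇒≈ᵁ L-∪) (｛′｝≈ᵁι* x))

  M₀-identityʳ : ∀ x → M₀ x 𝟏 ≐ L ｛ x ｝
  M₀-identityʳ x =
      (λ w∈M → λ { _ refl → w∈M x (inj₁ λ { _ (inj₁ refl) → ≤-refl
                                          ; _ (inj₂ refl) → x′≤y⇒y′≤x (𝟏-max (x ′)) }) })
    , (λ w≤x → λ { u (inj₁ x𝟏′≤u) → ≤-trans (w≤x x refl) (x𝟏′≤u x (inj₁ refl))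
                 ; _ (inj₂ refl) → 𝟏-max _ })

  M₀-identityˡ : ∀ x → M₀ 𝟏 x ≐ L ｛ x ｝
  M₀-identityˡ x =
      (λ w∈M → λ { _ refl → w∈M x (inj₂ refl) })
    , (λ w≤x → λ { u (inj₁ 𝟏x′≤u) → ≤-trans (𝟏-max _) (𝟏x′≤u 𝟏 (inj₁ refl))
                 ; _ (inj₂ refl) → w≤x x refl })

  R₀-zero : ∀ x → R₀ x 𝟎 ≐ L ｛ x ′ ｝
  R₀-zero x =
      (λ w∈R → λ { _ refl → w∈R (x ′) λ { _ (inj₁ y≤x0) → ≤-trans (y≤x0 𝟎 (inj₂ refl)) (𝟎-min _)
                                         ; _ (inj₂ refl) → ≤-refl } })
    , (λ w≤x′ u x′≤u → ≤-trans (w≤x′ (x ′) refl) (x′≤u (x ′) (inj₂ refl)))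

  M₀-R₀-residuated : ∀ x y z → (M₀ x y ⊆ L ｛ z ｝) ⇔ (L ｛ x ｝ ⊆ R₀ y z)
  M₀-R₀-residuated x y z = mk⇔
    (λ M⊆Lz {w} w≤x → proj₂ (R₀-⇛ y z) (to (λ {v} v∈⊙ → M⊆Lz (proj₂ (M₀-⊙ x y) v∈⊙)) {w} w≤x))
    (λ Lx⊆R {w} w∈M → from (λ {v} v≤x → proj₁ (R₀-⇛ y z) (Lx⊆R v≤x)) {w} (proj₁ (M₀-⊙ x y) w∈M))
    where open Equivalence (⊙-⇛-residuated (ι x) (ι y) (ι z))

  M₀-R₀-divisible : ∀ x y → Mˢ (R₀ x y) x ≐ L ⟪ x , y ⟫
  M₀-R₀-divisible x y = begin
    Mˢ (R₀ x y) x                   ≈⟨ Mˢ-⊙ (ι x ⇛ ι y) x (≐⇒≈ᵁ (R₀-⇛ x y)) ⟩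
    carrier ((ι x ⇛ ι y) ⊙ ι x)     ≈⟨ ⇛-⊙-divisible (ι x) (ι y) ⟩
    carrier (ι x ∧ ι y)             ≈⟨ ≐-sym L-∪ ⟩
    L ⟪ x , y ⟫                     ∎

  isDivisibleOpLeftResiduated : IsDivisibleOpLeftResiduated M₀ R₀
  isDivisibleOpLeftResiduated =
    M₀-identityʳ , M₀-identityˡ , M₀-R₀-residuated , R₀-zero , M₀-R₀-divisible

corollary14 : (𝐏 : Orthoposet) → let open OnOrthoposet 𝐏 in
    ModularD →
      StrictlyModular
    × IsDivisibleOpLeftResiduated M₀ R₀
    × Σ (DM → DM) (λ _* →
          ExtendsComplement _*
        × IsModularOrtholattice _*
        × IsOrthomodularLattice _*
        × IsDivisibleLeftResiduatedLattice (⊙[ _* ]) (⇒[ _* ]))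
corollary14 𝐏 modular =
    strictlyModular
  , isDivisibleOpLeftResiduated
  , _*
  , ι-*
  , (isBoundedLattice , isOrthocomplementation , modular)
  , (isBoundedLattice , isOrthocomplementation , orthomodular)
  , (isBoundedLattice , ⊙-identityʳ , ⊙-identityˡ , ⊙-⇛-residuated , ⇛-⊙-divisible)
  where
    open CompletionProperties 𝐏
    open ModularCompletionProperties 𝐏 modular
    open EmbeddingProperties 𝐏 modular
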